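{- Let $X = X_1 \uplus X_2$ be a finite set of products partitioned into two levels, with utilities $u(x) > 0$, a no-purchase utility $u_0 > 0$, and revenues $r(x) \ge 0$. Let $S^*$ be an optimal assortment under the Sequential Multinomial Logit model and $R^* = R(S^*) = \max_{S \subseteq X} R(S)$. Then for every nonempty $S_0 \subseteq S^*$, $\alpha(S_0) \ge R^*$.
   Context: For $S \subseteq X$ write $S_i = S \cap X_i$ ($i=1,2$), $U(S) = \sum_{x \in S} u(x)$, and for nonempty $S$, $\alpha(S) = \frac{\sum_{x \in S} u(x) r(x)}{U(S)}$. The Sequential Multinomial Logit (SML) model gives, for an offered assortment $S \subseteq X$, choice probabilities $\rho(x,S) = \frac{u(x)}{U(S)+u_0}$ if $x \in S_1$, and $\rho(x,S) = \left(1 - \frac{U(S_1)}{U(S)+u_0}\right)\frac{u(x)}{U(S)+u_0}$ if $x \in S_2$. The expected revenue is $R(S) = \sum_{x \in S} \rho(x,S) r(x)$.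
   Formalization: The utilities $u(x)$, the no-purchase utility $u_0$ and the revenues $r(x)$ are rational rather than real. -}

module Defs where

open import Data.Bool using (Bool; true; false; if_then_else_)
open import Data.Nat using (ℕ; zero; suc)
open import Data.Fin using (Fin; zero; suc)
open import Data.Fin.Subset using (Subset; _∩_; ∁)
open import Data.Vec using (Vec; []; _∷_; lookup)
open import Data.Rational using (ℚ; 0ℚ; 1ℚ; _+_; _*_; _-_; _÷_; _≟_; ≢-nonZero)
open import Relation.Nullary using (yes; no)

-- Total division on ℚ with the (irrelevant here) convention p / 0 = 0.
-- All denominators in this development are positive under the hypotheses.
_/'_ : ℚ → ℚ → ℚ
p /' q with q ≟ 0ℚ
... | yes _  = 0ℚ
... | no q≢0 = _÷_ p q {{≢-nonZero q≢0}}

ΣS : ∀ {n} → Subset n → (Fin n → ℚ) → ℚ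
ΣS {zero}  []      f = 0ℚ
ΣS {suc n} (b ∷ S) f = (if b then f zero else 0ℚ) + ΣS S (λ i → f (suc i))

module SML {n : ℕ} (X₁ : Subset n) (u : Fin n → ℚ) (u₀ : ℚ) (r : Fin n → ℚ) where

  X₂ : Subset n
  X₂ = ∁ X₁

  U : Subset n → ℚ
  U S = ΣS S u

  α : Subset n → ℚ
  α S = ΣS S (λ x → u x * r x) /' U S

  ρ : Fin n → Subset n → ℚ
  ρ x S = if lookup X₁ x
            then u x /' (U S + u₀)
            else ((1ℚ - (U (S ∩ X₁) /' (U S + u₀))) * (u x /' (U S + u₀)))

  R : Subset n → ℚ
  R S = ΣS S (λ x → ρ x S * r x)

{-# OPTIONS --safe #-}
module Submission where

-- Write V = U(S) + u₀, W = U(S₂) + u₀, A = Σ_{S₁} u r and B = Σ_{S₂} u r.  Then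
-- R(S)·V² = A·V + W·B, so for R* = R(S*) the deficit R*·V² − (A·V + W·B) is
-- nonnegative for every assortment S and vanishes at S*.  Removing a product x from
-- S* changes the aggregates linearly, and the resulting change of the deficit
-- factors as u(x)·((r(x) − R*)·c − e) with c > 0 and e ≥ 0; for a level-2 product,
-- e ≥ 0 because the level-2 part S*₂ alone earns at most R*.  Hence r(x) ≥ R* for
-- every x ∈ S*, and α(S₀), a u-weighted average of such revenues, is at least R*.

open import Algebra.Bundles using (CommutativeMonoid)
open import Data.Bool using (Bool; true; false; if_then_else_; _∧_; not)
open import Data.Fin using (Fin; zero; suc)
open import Data.Fin.Subset
  using (Subset; _⊆_; Nonempty; _∈_; _∉_; _∩_; ∁; ⊥; inside; outside)
  renaming (_-_ to _∖_)
open import Data.Fin.Subset.Properties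
  using ( p─⊥≡p; p∩q⊆q; x∈p∩q⁺; x∈p⇒x∉∁p; x∉p⇒x∈∁p; x∈∁p⇒x∉p; _∈?_
        ; ∩-assoc; ∩-idem; ∩-inverseˡ; ∩-zeroʳ; drop-not-there )
open import Data.Nat using (ℕ)
open import Data.Product using (_,_)
open import Data.Sum using (inj₁; inj₂)
open import Data.Rational
  using ( ℚ; 0ℚ; 1ℚ; _+_; _*_; -_; _-_; _≤_; _<_; _≟_
        ; ≢-nonZero; positive; nonNegative; nonPositive )
open import Data.Rational.Properties
  using ( +-*-commutativeRing; +-0-commutativeMonoid; *-1-commutativeMonoid
        ; ≤-refl; ≤-reflexive; ≤-trans; ≤-total; <⇒≤; <⇒≢
        ; +-mono-≤; +-mono-≤-<; +-monoˡ-≤; +-monoʳ-≤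
        ; +-identityˡ; +-identityʳ; +-inverseʳ; +-assoc
        ; *-assoc; *-comm; *-zeroʳ; *-identityʳ; *-inverseˡ; *-distribˡ-+
        ; *-cancelˡ-≤-pos; *-cancelʳ-≤-pos; *-monoʳ-≤-nonNeg; *-monoˡ-≤-nonNeg
        ; nonNeg*nonNeg⇒nonNeg; nonPos*nonPos⇒nonPos; nonNegative⁻¹; module ≤-Reasoning )
open import Data.Vec using ([]; _∷_; lookup; here; there)
open import Data.Vec.Properties using ([]=⇒lookup; lookup⇒[]=)
open import Relation.Binary.PropositionalEquality
  using (_≡_; _≢_; refl; sym; trans; cong; cong₂; subst; subst₂; ≢-sym; module ≡-Reasoning)
open import Relation.Nullary using (yes; no; contradiction)
open import Relation.Nullary.Decidable using (dec⇒maybe)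
open import Tactic.RingSolver using (solve-∀)
open import Tactic.RingSolver.Core.AlmostCommutativeRing
  using (AlmostCommutativeRing; fromCommutativeRing)

open import Algebra.Properties.CommutativeSemigroup
  (CommutativeMonoid.commutativeSemigroup +-0-commutativeMonoid)
  using () renaming (xy∙z≈xz∙y to +-right-comm)
open import Algebra.Properties.CommutativeSemigroup
  (CommutativeMonoid.commutativeSemigroup *-1-commutativeMonoid)
  using () renaming (xy∙z≈xz∙y to *-right-comm)

open import Defs

ℚ-ring : AlmostCommutativeRing _ _
ℚ-ring = fromCommutativeRing +-*-commutativeRing (λ q → dec⇒maybe (0ℚ ≟ q))

p≤q⇒0≤q-p : ∀ {p q} → p ≤ q → 0ℚ ≤ q - p
p≤q⇒0≤q-p {p} {q} p≤q = subst (_≤ q - p) (+-inverseʳ p) (+-monoˡ-≤ (- p) p≤q)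

0≤q-p⇒p≤q : ∀ {p q} → 0ℚ ≤ q - p → p ≤ q
0≤q-p⇒p≤q {p} {q} 0≤q-p =
  subst₂ _≤_ (+-identityʳ p) (p+[q-p]≡q p q) (+-monoʳ-≤ p 0≤q-p)
  where
  p+[q-p]≡q : ∀ p q → p + (q - p) ≡ q
  p+[q-p]≡q = solve-∀ ℚ-ring

0≤p⇒q≡0⇒0≤p-q : ∀ {p q} → 0ℚ ≤ p → q ≡ 0ℚ → 0ℚ ≤ p - q
0≤p⇒q≡0⇒0≤p-q {p} 0≤p refl = subst (0ℚ ≤_) (sym (+-identityʳ p)) 0≤p

*-nonNeg : ∀ {p q} → 0ℚ ≤ p → 0ℚ ≤ q → 0ℚ ≤ p * q
*-nonNeg {p} {q} 0≤p 0≤q =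
  nonNegative⁻¹ (p * q) {{nonNeg*nonNeg⇒nonNeg p {{nonNegative 0≤p}} q {{nonNegative 0≤q}}}}

0≤p*p : ∀ p → 0ℚ ≤ p * p
0≤p*p p with ≤-total 0ℚ p
... | inj₁ 0≤p = *-nonNeg 0≤p 0≤p
... | inj₂ p≤0 =
  nonNegative⁻¹ (p * p) {{nonPos*nonPos⇒nonPos p {{nonPositive p≤0}} p {{nonPositive p≤0}}}}

0<p⇒0≤p*q⇒0≤q : ∀ {p q} → 0ℚ < p → 0ℚ ≤ p * q → 0ℚ ≤ q
0<p⇒0≤p*q⇒0≤q {p} {q} 0<p 0≤pq =
  *-cancelˡ-≤-pos p {{positive 0<p}} (subst (_≤ p * q) (sym (*-zeroʳ p)) 0≤pq)

0≤u*[[r-R]*c-e]⇒R≤r : ∀ {R r u c e} → 0ℚ < u → 0ℚ < c → 0ℚ ≤ e →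
                       0ℚ ≤ u * ((r - R) * c - e) → R ≤ r
0≤u*[[r-R]*c-e]⇒R≤r {R} {r} {u} {c} {e} 0<u 0<c 0≤e 0≤margin =
  0≤q-p⇒p≤q (0<p⇒0≤p*q⇒0≤q 0<c (subst (0ℚ ≤_) (*-comm (r - R) c) (begin
    0ℚ            ≤⟨ 0≤e ⟩
    e             ≤⟨ 0≤q-p⇒p≤q (0<p⇒0≤p*q⇒0≤q 0<u 0≤margin) ⟩
    (r - R) * c   ∎)))
  where open ≤-Reasoning

p/'q*q≡p : ∀ p {q} → q ≢ 0ℚ → (p /' q) * q ≡ p
p/'q*q≡p p {q} q≢0 with q ≟ 0ℚ
... | yes q≡0 = contradiction q≡0 q≢0
... | no  q≢0 =
  trans (*-assoc p _ q) (trans (cong (p *_) (*-inverseˡ q {{≢-nonZero q≢0}})) (*-identityʳ p))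

∉⇒lookup≡outside : ∀ {n} {p : Subset n} {x} → x ∉ p → lookup p x ≡ outside
∉⇒lookup≡outside {p = p} {x} x∉p with lookup p x in eq
... | inside  = contradiction (lookup⇒[]= x p eq) x∉p
... | outside = refl

[p∖x]∩q≡p∩q∖x : ∀ {n} (p q : Subset n) x → (p ∖ x) ∩ q ≡ p ∩ q ∖ x
[p∖x]∩q≡p∩q∖x (_ ∷ p) (_ ∷ q) zero =
  cong (outside ∷_) (trans (cong (_∩ q) (p─⊥≡p p)) (sym (p─⊥≡p (p ∩ q))))
[p∖x]∩q≡p∩q∖x (_ ∷ p) (_ ∷ q) (suc x) = cong (_ ∷_) ([p∖x]∩q≡p∩q∖x p q x)

x∉p⇒p∖x≡p : ∀ {n} {p : Subset n} {x} → x ∉ p → p ∖ x ≡ p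
x∉p⇒p∖x≡p {p = inside  ∷ p} {zero}  x∉p = contradiction here x∉p
x∉p⇒p∖x≡p {p = outside ∷ p} {zero}  x∉p = cong (outside ∷_) (p─⊥≡p p)
x∉p⇒p∖x≡p {p = _       ∷ p} {suc x} x∉p = cong (_ ∷_) (x∉p⇒p∖x≡p (drop-not-there x∉p))

x∉q⇒[p∖x]∩q≡p∩q : ∀ {n} (p : Subset n) {q x} → x ∉ q → (p ∖ x) ∩ q ≡ p ∩ q
x∉q⇒[p∖x]∩q≡p∩q p {q} {x} x∉q =
  trans ([p∖x]∩q≡p∩q∖x p q x) (x∉p⇒p∖x≡p (λ x∈p∩q → x∉q (p∩q⊆q p q x∈p∩q)))

ΣS-cong-∈ : ∀ {n} (S : Subset n) {f g : Fin n → ℚ} →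
            (∀ {x} → x ∈ S → f x ≡ g x) → ΣS S f ≡ ΣS S g
ΣS-cong-∈ []            f≡g = refl
ΣS-cong-∈ (inside  ∷ S) f≡g = cong₂ _+_ (f≡g here) (ΣS-cong-∈ S (λ x∈S → f≡g (there x∈S)))
ΣS-cong-∈ (outside ∷ S) f≡g = cong (0ℚ +_) (ΣS-cong-∈ S (λ x∈S → f≡g (there x∈S)))

ΣS-mono-∈ : ∀ {n} (S : Subset n) {f g : Fin n → ℚ} →
            (∀ {x} → x ∈ S → f x ≤ g x) → ΣS S f ≤ ΣS S g
ΣS-mono-∈ []            f≤g = ≤-refl
ΣS-mono-∈ (inside  ∷ S) f≤g = +-mono-≤ (f≤g here) (ΣS-mono-∈ S (λ x∈S → f≤g (there x∈S)))
ΣS-mono-∈ (outside ∷ S) f≤g = +-mono-≤ (≤-refl {0ℚ}) (ΣS-mono-∈ S (λ x∈S → f≤g (there x∈S)))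

ΣS-nonNeg : ∀ {n} (S : Subset n) {f : Fin n → ℚ} → (∀ x → 0ℚ ≤ f x) → 0ℚ ≤ ΣS S f
ΣS-nonNeg []            0≤f = ≤-refl
ΣS-nonNeg (inside  ∷ S) 0≤f = +-mono-≤ (0≤f zero) (ΣS-nonNeg S (λ x → 0≤f (suc x)))
ΣS-nonNeg (outside ∷ S) 0≤f = +-mono-≤ (≤-refl {0ℚ}) (ΣS-nonNeg S (λ x → 0≤f (suc x)))

ΣS-⊥ : ∀ {n} (f : Fin n → ℚ) → ΣS ⊥ f ≡ 0ℚ
ΣS-⊥ {ℕ.zero}  f = refl
ΣS-⊥ {ℕ.suc n} f = cong (0ℚ +_) (ΣS-⊥ (λ x → f (suc x)))

*-distribˡ-ΣS : ∀ {n} (S : Subset n) k (f : Fin n → ℚ) → k * ΣS S f ≡ ΣS S (λ x → k * f x)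
*-distribˡ-ΣS []            k f = *-zeroʳ k
*-distribˡ-ΣS (inside  ∷ S) k f =
  trans (*-distribˡ-+ k (f zero) _) (cong (k * f zero +_) (*-distribˡ-ΣS S k (λ x → f (suc x))))
*-distribˡ-ΣS (outside ∷ S) k f =
  trans (cong (k *_) (+-identityˡ _))
        (trans (*-distribˡ-ΣS S k (λ x → f (suc x))) (sym (+-identityˡ _)))

*-distribʳ-ΣS : ∀ {n} (S : Subset n) k (f : Fin n → ℚ) → ΣS S f * k ≡ ΣS S (λ x → f x * k)
*-distribʳ-ΣS S k f =
  trans (*-comm _ k) (trans (*-distribˡ-ΣS S k f) (ΣS-cong-∈ S (λ {x} _ → *-comm k (f x))))

ΣS-split : ∀ {n} (S T : Subset n) (f : Fin n → ℚ) → ΣS S f ≡ ΣS (S ∩ T) f + ΣS (S ∩ ∁ T) f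
ΣS-split []      []      f = refl
ΣS-split (s ∷ S) (t ∷ T) f =
  trans (cong (head s +_) (ΣS-split S T f′)) (regroup s t (ΣS (S ∩ T) f′) (ΣS (S ∩ ∁ T) f′))
  where
  f′ : Fin _ → ℚ
  f′ x = f (suc x)
  head : Bool → ℚ
  head b = if b then f zero else 0ℚ
  shape₁ : ∀ a P Q → a + (P + Q) ≡ (a + P) + (0ℚ + Q)
  shape₁ = solve-∀ ℚ-ring
  shape₂ : ∀ a P Q → a + (P + Q) ≡ (0ℚ + P) + (a + Q)
  shape₂ = solve-∀ ℚ-ring
  shape₃ : ∀ P Q → 0ℚ + (P + Q) ≡ (0ℚ + P) + (0ℚ + Q)
  shape₃ = solve-∀ ℚ-ring
  regroup : ∀ s t P Q → head s + (P + Q) ≡ (head (s ∧ t) + P) + (head (s ∧ not t) + Q)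
  regroup true  true  = shape₁ (f zero)
  regroup true  false = shape₂ (f zero)
  regroup false _     = shape₃

ΣS-∩-≤ : ∀ {n} (S T : Subset n) {f : Fin n → ℚ} → (∀ x → 0ℚ ≤ f x) → ΣS (S ∩ T) f ≤ ΣS S f
ΣS-∩-≤ S T {f} 0≤f = begin
  ΣS (S ∩ T) f                       ≡⟨ sym (+-identityʳ _) ⟩
  ΣS (S ∩ T) f + 0ℚ                  ≤⟨ +-monoʳ-≤ (ΣS (S ∩ T) f) (ΣS-nonNeg (S ∩ ∁ T) 0≤f) ⟩
  ΣS (S ∩ T) f + ΣS (S ∩ ∁ T) f      ≡⟨ sym (ΣS-split S T f) ⟩
  ΣS S f                             ∎
  where open ≤-Reasoning

ΣS-remove : ∀ {n} {S : Subset n} {x} (f : Fin n → ℚ) → x ∈ S → ΣS S f ≡ ΣS (S ∖ x) f + f x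
ΣS-remove {S = inside ∷ S} f here =
  trans (shape (f zero) (ΣS S (λ x → f (suc x))))
        (cong (λ P → 0ℚ + ΣS P (λ x → f (suc x)) + f zero) (sym (p─⊥≡p S)))
  where
  shape : ∀ a b → a + b ≡ 0ℚ + b + a
  shape = solve-∀ ℚ-ring
ΣS-remove {S = s ∷ S} {suc x} f (there x∈S) =
  trans (cong (head +_) (ΣS-remove f′ x∈S)) (sym (+-assoc head (ΣS (S ∖ x) f′) (f′ x)))
  where
  f′ : Fin _ → ℚ
  f′ x = f (suc x)
  head : ℚ
  head = if s then f zero else 0ℚ

ΣS-∩-remove : ∀ {n} {S T : Subset n} {x} (f : Fin n → ℚ) → x ∈ S → x ∈ T →
              ΣS (S ∩ T) f ≡ ΣS ((S ∖ x) ∩ T) f + f x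
ΣS-∩-remove {S = S} {T} {x} f x∈S x∈T =
  trans (ΣS-remove f (x∈p∩q⁺ (x∈S , x∈T)))
        (cong (λ P → ΣS P f + f x) (sym ([p∖x]∩q≡p∩q∖x S T x)))

ΣS-pos : ∀ {n} (S : Subset n) {f : Fin n → ℚ} {x} →
         x ∈ S → (∀ y → 0ℚ ≤ f y) → 0ℚ < f x → 0ℚ < ΣS S f
ΣS-pos S {f} {x} x∈S 0≤f 0<fx =
  subst (0ℚ <_) (sym (ΣS-remove f x∈S)) (+-mono-≤-< (ΣS-nonNeg (S ∖ x) 0≤f) 0<fx)

≤-weightedAverage : ∀ {n} (S : Subset n) {w f : Fin n → ℚ} {c} →
                    0ℚ < ΣS S w → (∀ x → 0ℚ ≤ w x) → (∀ {x} → x ∈ S → c ≤ f x) →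
                    c ≤ ΣS S (λ x → w x * f x) /' ΣS S w
≤-weightedAverage S {w} {f} {c} 0<Σw 0≤w c≤f =
  *-cancelʳ-≤-pos (ΣS S w) {{positive 0<Σw}} (begin
    c * ΣS S w                  ≡⟨ *-distribˡ-ΣS S c w ⟩
    ΣS S (λ x → c * w x)        ≤⟨ ΣS-mono-∈ S c*w≤w*f ⟩
    ΣS S wf                     ≡⟨ sym (p/'q*q≡p (ΣS S wf) (≢-sym (<⇒≢ 0<Σw))) ⟩
    (ΣS S wf /' ΣS S w) * ΣS S w ∎)
  where
  open ≤-Reasoning
  wf : Fin _ → ℚ
  wf x = w x * f x
  c*w≤w*f : ∀ {x} → x ∈ S → c * w x ≤ w x * f x
  c*w≤w*f {x} x∈S =
    subst (c * w x ≤_) (*-comm (f x) (w x))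
          (*-monoʳ-≤-nonNeg (w x) {{nonNegative (0≤w x)}} (c≤f x∈S))

-- Deficit of a revenue level

record Aggregates : Set where
  constructor ⟨_,_,_,_⟩
  field
    V W A B : ℚ

open Aggregates

⟨,,,⟩-cong : ∀ {V V′ W W′ A A′ B B′} → V ≡ V′ → W ≡ W′ → A ≡ A′ → B ≡ B′ →
             ⟨ V , W , A , B ⟩ ≡ ⟨ V′ , W′ , A′ , B′ ⟩
⟨,,,⟩-cong refl refl refl refl = refl

deficit : ℚ → Aggregates → ℚ
deficit R ⟨ V , W , A , B ⟩ = R * (V * V) - (A * V + W * B)

addLevel₁ : ℚ → ℚ → Aggregates → Aggregates
addLevel₁ u r ⟨ V , W , A , B ⟩ = ⟨ V + u , W , A + u * r , B ⟩

addLevel₂ : ℚ → ℚ → Aggregates → Aggregates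
addLevel₂ u r ⟨ V , W , A , B ⟩ = ⟨ V + u , W + u , A , B + u * r ⟩

level₂Part : Aggregates → Aggregates
level₂Part ⟨ V , W , A , B ⟩ = ⟨ W , W , 0ℚ , B ⟩

-- With a, b the level sums of (u/V)·r and m = U(S₁)/V, the SML revenue is a + (1 − m)·b.
sml-deficit≡0 : ∀ {a b m V A B U₁ W} → a * V ≡ A → b * V ≡ B → m * V ≡ U₁ → W ≡ V - U₁ →
                deficit (a + (1ℚ - m) * b) ⟨ V , W , A , B ⟩ ≡ 0ℚ
sml-deficit≡0 {a} {b} {m} {V} refl refl refl refl = identity a b m V
  where
  identity : ∀ a b m V →
             (a + (1ℚ - m) * b) * (V * V) - (a * V * V + (V - m * V) * (b * V)) ≡ 0ℚ
  identity = solve-∀ ℚ-ring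

deficit≡0⇒0≤deficit : ∀ {R R′} s → R ≤ R′ → deficit R s ≡ 0ℚ → 0ℚ ≤ deficit R′ s
deficit≡0⇒0≤deficit {R} {R′} s@(⟨ V , W , A , B ⟩) R≤R′ deficit≡0 = begin
  0ℚ                          ≤⟨ *-nonNeg (p≤q⇒0≤q-p R≤R′) (0≤p*p V) ⟩
  (R′ - R) * (V * V)          ≡⟨ sym (+-identityʳ _) ⟩
  (R′ - R) * (V * V) + 0ℚ     ≡⟨ cong ((R′ - R) * (V * V) +_) (sym deficit≡0) ⟩
  (R′ - R) * (V * V) + deficit R s ≡⟨ difference R R′ V W A B ⟩
  deficit R′ s                ∎
  where
  open ≤-Reasoning
  difference : ∀ R R′ V W A B → (R′ - R) * (V * V) + (R * (V * V) - (A * V + W * B))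
                              ≡ R′ * (V * V) - (A * V + W * B)
  difference = solve-∀ ℚ-ring

0≤deficit-level₂Part⇒B≤R*W : ∀ {R} s → 0ℚ < W s → 0ℚ ≤ deficit R (level₂Part s) →
                             B s ≤ R * W s
0≤deficit-level₂Part⇒B≤R*W {R} ⟨ _ , W , _ , B ⟩ 0<W 0≤deficit =
  0≤q-p⇒p≤q (0<p⇒0≤p*q⇒0≤q 0<W (subst (0ℚ ≤_) (factor R W B) 0≤deficit))
  where
  factor : ∀ R W B → R * (W * W) - (0ℚ * W + W * B) ≡ W * (R * W - B)
  factor = solve-∀ ℚ-ring

addLevel₁-optimal⇒R≤r : ∀ {R u r} s → 0ℚ < u → 0ℚ < V s → 0ℚ ≤ W s * B s →
               deficit R (addLevel₁ u r s) ≡ 0ℚ → 0ℚ ≤ deficit R s → R ≤ r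
addLevel₁-optimal⇒R≤r {R} {u} {r} ⟨ V , W , A , B ⟩ 0<u 0<V 0≤WB deficit₊≡0 0≤deficit =
  0≤u*[[r-R]*c-e]⇒R≤r 0<u 0<V+u 0≤RV-A
    (subst (0ℚ ≤_) (drop R u r V W A B) (0≤p⇒q≡0⇒0≤p-q 0≤deficit deficit₊≡0))
  where
  0<V+u : 0ℚ < V + u
  0<V+u = +-mono-≤-< (<⇒≤ 0<V) 0<u
  drop : ∀ R u r V W A B → R * (V * V) - (A * V + W * B)
           - (R * ((V + u) * (V + u)) - ((A + u * r) * (V + u) + W * B))
         ≡ u * ((r - R) * (V + u) - (R * V - A))
  drop = solve-∀ ℚ-ring
  factor : ∀ R V W A B → V * (R * V - A) ≡ (R * (V * V) - (A * V + W * B)) + W * B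
  factor = solve-∀ ℚ-ring
  0≤RV-A : 0ℚ ≤ R * V - A
  0≤RV-A = 0<p⇒0≤p*q⇒0≤q 0<V
             (subst (0ℚ ≤_) (sym (factor R V W A B)) (+-mono-≤ 0≤deficit 0≤WB))

addLevel₂-optimal⇒R≤r : ∀ {R u r} s → 0ℚ < u → 0ℚ < W s → W s ≤ V s → 0ℚ ≤ R →
               0ℚ ≤ deficit R (level₂Part (addLevel₂ u r s)) →
               deficit R (addLevel₂ u r s) ≡ 0ℚ → 0ℚ ≤ deficit R s → R ≤ r
addLevel₂-optimal⇒R≤r {R} {u} {r} ⟨ V , W , A , B ⟩
                      0<u 0<W W≤V 0≤R 0≤deficit₂ deficit₊≡0 0≤deficit =
  0≤u*[[r-R]*c-e]⇒R≤r 0<u 0<W 0≤F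
    (subst (0ℚ ≤_) (drop R u r V W A B) (0≤p⇒q≡0⇒0≤p-q 0≤deficit deficit₊≡0))
  where
  drop : ∀ R u r V W A B → R * (V * V) - (A * V + W * B)
           - (R * ((V + u) * (V + u)) - (A * (V + u) + (W + u) * (B + u * r)))
         ≡ u * ((r - R) * W - (R * (V + u + (V - W)) - A - (B + u * r)))
  drop = solve-∀ ℚ-ring
  factor : ∀ R u r V W A B → (V + u) * (R * (V + u + (V - W)) - A - (B + u * r))
         ≡ (V - W) * (R * (V + u) - (B + u * r))
           + (R * ((V + u) * (V + u)) - (A * (V + u) + (W + u) * (B + u * r)))
  factor = solve-∀ ℚ-ring
  0<V+u : 0ℚ < V + u
  0<V+u = +-mono-≤-< (≤-trans (<⇒≤ 0<W) W≤V) 0<u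
  0<W+u : 0ℚ < W + u
  0<W+u = +-mono-≤-< (<⇒≤ 0<W) 0<u
  B₊≤R*V₊ : B + u * r ≤ R * (V + u)
  B₊≤R*V₊ = ≤-trans (0≤deficit-level₂Part⇒B≤R*W {R} (addLevel₂ u r ⟨ V , W , A , B ⟩)
                                                   0<W+u 0≤deficit₂)
                    (*-monoˡ-≤-nonNeg R {{nonNegative 0≤R}} (+-monoˡ-≤ u W≤V))
  0≤F : 0ℚ ≤ R * (V + u + (V - W)) - A - (B + u * r)
  0≤F = 0<p⇒0≤p*q⇒0≤q 0<V+u (subst (0ℚ ≤_) (sym (factor R u r V W A B))
          (+-mono-≤ (*-nonNeg (p≤q⇒0≤q-p W≤V) (p≤q⇒0≤q-p B₊≤R*V₊))
                    (≤-reflexive (sym deficit₊≡0))))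

module Aggregation {n : ℕ} (X₁ : Subset n) (u : Fin n → ℚ) (u₀ : ℚ) (r : Fin n → ℚ) where
  open SML X₁ u u₀ r

  ur : Fin n → ℚ
  ur x = u x * r x

  aggregates : Subset n → Aggregates
  aggregates S = ⟨ U S + u₀ , U (S ∩ X₂) + u₀ , ΣS (S ∩ X₁) ur , ΣS (S ∩ X₂) ur ⟩

  revenue-deficit≡0 : ∀ S → U S + u₀ ≢ 0ℚ → deficit (R S) (aggregates S) ≡ 0ℚ
  revenue-deficit≡0 S V≢0 =
    subst (λ R′ → deficit R′ (aggregates S) ≡ 0ℚ) (sym R≡)
      (sml-deficit≡0 {ΣS (S ∩ X₁) cr} {ΣS (S ∩ X₂) cr} {m} {U S + u₀}
        (level-sum*V X₁) (level-sum*V X₂) (p/'q*q≡p (U (S ∩ X₁)) V≢0) W≡V-U₁)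
    where
    open ≡-Reasoning
    c : Fin n → ℚ
    c x = u x /' (U S + u₀)
    m : ℚ
    m = U (S ∩ X₁) /' (U S + u₀)
    cr : Fin n → ℚ
    cr x = c x * r x
    level-sum*V : ∀ T → ΣS (S ∩ T) cr * (U S + u₀) ≡ ΣS (S ∩ T) ur
    level-sum*V T = trans (*-distribʳ-ΣS (S ∩ T) (U S + u₀) cr) (ΣS-cong-∈ (S ∩ T) (λ {x} _ →
      trans (*-right-comm (c x) (r x) (U S + u₀)) (cong (_* r x) (p/'q*q≡p (u x) V≢0))))
    ρ-level₁ : ∀ {x} → x ∈ S ∩ X₁ → ρ x S * r x ≡ cr x
    ρ-level₁ {x} x∈S₁ = cong (λ b → (if b then c x else (1ℚ - m) * c x) * r x)
                              ([]=⇒lookup (p∩q⊆q S X₁ x∈S₁))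
    ρ-level₂ : ∀ {x} → x ∈ S ∩ X₂ → ρ x S * r x ≡ (1ℚ - m) * cr x
    ρ-level₂ {x} x∈S₂ = trans (cong (λ b → (if b then c x else (1ℚ - m) * c x) * r x)
                                    (∉⇒lookup≡outside (x∈∁p⇒x∉p (p∩q⊆q S X₂ x∈S₂))))
                              (*-assoc (1ℚ - m) (c x) (r x))
    R≡ : R S ≡ ΣS (S ∩ X₁) cr + (1ℚ - m) * ΣS (S ∩ X₂) cr
    R≡ = begin
      R S
        ≡⟨ ΣS-split S X₁ (λ x → ρ x S * r x) ⟩
      ΣS (S ∩ X₁) (λ x → ρ x S * r x) + ΣS (S ∩ X₂) (λ x → ρ x S * r x)
        ≡⟨ cong₂ _+_ (ΣS-cong-∈ (S ∩ X₁) ρ-level₁)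
                     (trans (ΣS-cong-∈ (S ∩ X₂) ρ-level₂)
                            (sym (*-distribˡ-ΣS (S ∩ X₂) (1ℚ - m) cr))) ⟩
      ΣS (S ∩ X₁) cr + (1ℚ - m) * ΣS (S ∩ X₂) cr
        ∎
    shape : ∀ a b c → b + c ≡ a + b + c - a
    shape = solve-∀ ℚ-ring
    W≡V-U₁ : U (S ∩ X₂) + u₀ ≡ U S + u₀ - U (S ∩ X₁)
    W≡V-U₁ = trans (shape (U (S ∩ X₁)) (U (S ∩ X₂)) u₀)
                   (cong (λ t → t + u₀ - U (S ∩ X₁)) (sym (ΣS-split S X₁ u)))

  V-remove : ∀ {S x} → x ∈ S → U S + u₀ ≡ U (S ∖ x) + u₀ + u x
  V-remove {S} {x} x∈S =
    trans (cong (_+ u₀) (ΣS-remove u x∈S)) (+-right-comm (U (S ∖ x)) (u x) u₀)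

  aggregates-remove₁ : ∀ {S x} → x ∈ S → x ∈ X₁ →
                       aggregates S ≡ addLevel₁ (u x) (r x) (aggregates (S ∖ x))
  aggregates-remove₁ {S} {x} x∈S x∈X₁ =
    ⟨,,,⟩-cong (V-remove x∈S) (cong (λ P → U P + u₀) (sym level₂-unchanged))
               (ΣS-∩-remove ur x∈S x∈X₁) (cong (λ P → ΣS P ur) (sym level₂-unchanged))
    where
    level₂-unchanged : (S ∖ x) ∩ X₂ ≡ S ∩ X₂
    level₂-unchanged = x∉q⇒[p∖x]∩q≡p∩q S (x∈p⇒x∉∁p x∈X₁)

  aggregates-remove₂ : ∀ {S x} → x ∈ S → x ∉ X₁ →
                       aggregates S ≡ addLevel₂ (u x) (r x) (aggregates (S ∖ x))
  aggregates-remove₂ {S} {x} x∈S x∉X₁ =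
    ⟨,,,⟩-cong (V-remove x∈S)
               (trans (cong (_+ u₀) (ΣS-∩-remove u x∈S x∈X₂))
                      (+-right-comm (U ((S ∖ x) ∩ X₂)) (u x) u₀))
               (cong (λ P → ΣS P ur) (sym (x∉q⇒[p∖x]∩q≡p∩q S x∉X₁)))
               (ΣS-∩-remove ur x∈S x∈X₂)
    where
    x∈X₂ : x ∈ X₂
    x∈X₂ = x∉p⇒x∈∁p x∉X₁

  aggregates-level₂Part : ∀ S → aggregates (S ∩ X₂) ≡ level₂Part (aggregates S)
  aggregates-level₂Part S =
    ⟨,,,⟩-cong refl (cong (λ P → U P + u₀) idem)
               (trans (cong (λ P → ΣS P ur) disjoint) (ΣS-⊥ ur)) (cong (λ P → ΣS P ur) idem)
    where
    idem : (S ∩ X₂) ∩ X₂ ≡ S ∩ X₂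
    idem = trans (∩-assoc S X₂ X₂) (cong (S ∩_) (∩-idem X₂))
    disjoint : (S ∩ X₂) ∩ X₁ ≡ ⊥
    disjoint = trans (∩-assoc S X₂ X₁) (trans (cong (S ∩_) (∩-inverseˡ X₁)) (∩-zeroʳ S))

module Optimality {n : ℕ} (X₁ : Subset n) (u : Fin n → ℚ) (u₀ : ℚ) (r : Fin n → ℚ)
  (0<u : ∀ x → 0ℚ < u x) (0<u₀ : 0ℚ < u₀) (0≤r : ∀ x → 0ℚ ≤ r x)
  (S* : Subset n) (S*-optimal : ∀ S → SML.R X₁ u u₀ r S ≤ SML.R X₁ u u₀ r S*) where
  open SML X₁ u u₀ r
  open Aggregation X₁ u u₀ r

  0≤u : ∀ x → 0ℚ ≤ u x
  0≤u x = <⇒≤ (0<u x)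

  0<V : ∀ S → 0ℚ < U S + u₀
  0<V S = +-mono-≤-< (ΣS-nonNeg S 0≤u) 0<u₀

  W≤V : ∀ S → U (S ∩ X₂) + u₀ ≤ U S + u₀
  W≤V S = +-monoˡ-≤ u₀ (ΣS-∩-≤ S X₂ 0≤u)

  0≤W*B : ∀ S → 0ℚ ≤ (U (S ∩ X₂) + u₀) * ΣS (S ∩ X₂) ur
  0≤W*B S =
    *-nonNeg (<⇒≤ (0<V (S ∩ X₂))) (ΣS-nonNeg (S ∩ X₂) (λ x → *-nonNeg (0≤u x) (0≤r x)))

  R* : ℚ
  R* = R S*

  0≤R* : 0ℚ ≤ R*
  0≤R* = subst (_≤ R*) (ΣS-⊥ (λ x → ρ x ⊥ * r x)) (S*-optimal ⊥)

  deficit*≡0 : deficit R* (aggregates S*) ≡ 0ℚ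
  deficit*≡0 = revenue-deficit≡0 S* (≢-sym (<⇒≢ (0<V S*)))

  0≤deficit : ∀ S → 0ℚ ≤ deficit R* (aggregates S)
  0≤deficit S =
    deficit≡0⇒0≤deficit (aggregates S) (S*-optimal S) (revenue-deficit≡0 S (≢-sym (<⇒≢ (0<V S))))

  R*≤r-level₁ : ∀ {x} → x ∈ S* → x ∈ X₁ → R* ≤ r x
  R*≤r-level₁ {x} x∈S* x∈X₁ =
    addLevel₁-optimal⇒R≤r (aggregates (S* ∖ x)) (0<u x) (0<V (S* ∖ x)) (0≤W*B (S* ∖ x))
      (subst (λ s → deficit R* s ≡ 0ℚ) (aggregates-remove₁ x∈S* x∈X₁) deficit*≡0)
      (0≤deficit (S* ∖ x))

  R*≤r-level₂ : ∀ {x} → x ∈ S* → x ∉ X₁ → R* ≤ r x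
  R*≤r-level₂ {x} x∈S* x∉X₁ =
    addLevel₂-optimal⇒R≤r (aggregates (S* ∖ x))
      (0<u x) (0<V ((S* ∖ x) ∩ X₂)) (W≤V (S* ∖ x)) 0≤R*
      (subst (λ s → 0ℚ ≤ deficit R* (level₂Part s)) removal
        (subst (λ s → 0ℚ ≤ deficit R* s) (aggregates-level₂Part S*) (0≤deficit (S* ∩ X₂))))
      (subst (λ s → deficit R* s ≡ 0ℚ) removal deficit*≡0)
      (0≤deficit (S* ∖ x))
    where
    removal : aggregates S* ≡ addLevel₂ (u x) (r x) (aggregates (S* ∖ x))
    removal = aggregates-remove₂ x∈S* x∉X₁

  R*≤r : ∀ {x} → x ∈ S* → R* ≤ r x
  R*≤r {x} x∈S* with x ∈? X₁
  ... | yes x∈X₁ = R*≤r-level₁ x∈S* x∈X₁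
  ... | no  x∉X₁ = R*≤r-level₂ x∈S* x∉X₁

corollary1 : ∀ (n : ℕ) (X₁ : Subset n) (u : Fin n → ℚ) (u₀ : ℚ) (r : Fin n → ℚ)
    → (∀ x → 0ℚ < u x) → 0ℚ < u₀ → (∀ x → 0ℚ ≤ r x)
    → (Sstar : Subset n)
    → (∀ (S : Subset n) → SML.R X₁ u u₀ r S ≤ SML.R X₁ u u₀ r Sstar)
    → ∀ (S₀ : Subset n) → S₀ ⊆ Sstar → Nonempty S₀
    → SML.R X₁ u u₀ r Sstar ≤ SML.α X₁ u u₀ r S₀
corollary1 n X₁ u u₀ r 0<u 0<u₀ 0≤r S* S*-optimal S₀ S₀⊆S* (x , x∈S₀) =
  ≤-weightedAverage S₀ (ΣS-pos S₀ x∈S₀ 0≤u (0<u x)) 0≤u (λ y∈S₀ → R*≤r (S₀⊆S* y∈S₀))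
  where open Optimality X₁ u u₀ r 0<u 0<u₀ 0≤r S* S*-optimal
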